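{- Let $k \geq 2$ and $t \geq 1$ be integers, and let $\sigma_1 = (1\,2\,3\ldots k)^t$ and $\sigma_2 = (k\ldots 3\,2\,1)^t$. Then $fw(\{\sigma_1,\sigma_2\}) = 2t-1$.
   Context: An ordered sequence is a finite sequence of symbols from a totally ordered alphabet. An ordered sequence $S$ order-contains an ordered sequence $u$ if some subsequence of $S$ can be obtained from $u$ by an injective order-preserving renaming of the letters. An $(r,s)$-formation is a concatenation of $s$ permutations of the same $r$ symbols. For a family $F$ of ordered sequences, $fw(F)$ (formation width) is the minimum $s$ for which there exists $r$ such that every $(r,s)$-formation (on an ordered alphabet of $r$ symbols) order-contains at least one member of $F$. For a sequence $w$, $w^t$ denotes the concatenation of $t$ copies of $w$. -}

module Defs where

open import Data.Nat using (ℕ; zero; suc; _<_)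
open import Data.List using (List; []; _∷_; _++_; map; concat; length; upTo; applyUpTo; reverse)
open import Data.List.Membership.Propositional using (_∈_)
open import Data.List.Relation.Binary.Sublist.Propositional using (_⊆_)
open import Data.List.Relation.Binary.Permutation.Propositional using (_↭_)
open import Data.List.Relation.Unary.All using (All)
open import Data.List.Relation.Unary.Any using (Any)
open import Data.Product using (Σ; ∃; _×_)
open import Relation.Binary.PropositionalEquality using (_≡_)
open import Relation.Nullary using (¬_)

OrderContains : List ℕ → List ℕ → Set
OrderContains S u =
  ∃ λ (f : ℕ → ℕ) →
    (∀ {a b} → a ∈ u → b ∈ u → a < b → f a < f b) × (map f u ⊆ S)

Formation : ℕ → ℕ → List ℕ → Set
Formation r s S =
  ∃ λ (ps : List (List ℕ)) →
    length ps ≡ s × All (λ p → p ↭ upTo r) ps × S ≡ concat ps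

Forces : List (List ℕ) → ℕ → Set
Forces F s = ∃ λ r → ∀ S → Formation r s S → Any (OrderContains S) F

FormationWidth : List (List ℕ) → ℕ → Set
FormationWidth F s = Forces F s × (∀ s' → s' < s → ¬ Forces F s')

_^ˢ_ : List ℕ → ℕ → List ℕ
w ^ˢ zero  = []
w ^ˢ suc t = w ++ (w ^ˢ t)

ascending : ℕ → List ℕ
ascending k = applyUpTo suc k

descending : ℕ → List ℕ
descending k = reverse (ascending k)

-- Upper bound: iterating Erdős–Szekeres through the permutations of a formation over a large
-- enough alphabet leaves k letters w₁ < … < w_k that every permutation lists in increasing or in
-- decreasing order. Among 2t − 1 permutations, t agree by pigeonhole, and renaming i ↦ wᵢ embeds
-- σ₁ or σ₂. Lower bound: in the zigzag formation id, rev, id, rev, … with s blocks, a block holds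
-- at most two consecutive letters of an alternation x y x y …, and two only if its direction
-- matches the first pair, so alternations have length at most s + 1; yet the images of 1 and 2
-- give both σ₁ and σ₂ an alternation of length 2t.
module Submission where

open import Defs
open import Data.Nat using (ℕ; zero; suc; _≤_; _<_; _>_; _∸_; _*_; _+_; z≤n; s≤s; _<?_; _≤?_; _≟_)
open import Data.Nat.Properties
open import Data.List using (List; []; _∷_; _++_; map; concat; length; upTo; applyUpTo; reverse; filter)
open import Data.List.Properties
  using (length-reverse; reverse-involutive; map-++; map-applyUpTo; reverse-map; unfold-reverse;
         filter-all; length-applyUpTo)
open import Data.List.Relation.Binary.Sublist.Propositional
  using (_⊆_; []; _∷_; _∷ʳ_; ⊆-refl; ⊆-trans; minimum; lookup)
open import Data.List.Relation.Binary.Sublist.Propositional.Properties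
  using (filter-⊆; filter⁺; ++⁺; ++⁺ˡ; reverse⁺; map⁺; length-mono-≤; All-resp-⊆)
open import Data.List.Relation.Unary.All as All using (All; []; _∷_)
open import Data.List.Relation.Unary.All.Properties using (all-filter) renaming (filter⁺ to All-filter⁺)
open import Data.List.Relation.Unary.AllPairs using (AllPairs; []; _∷_)
import Data.List.Relation.Unary.AllPairs.Properties as AllPairs
open import Data.List.Relation.Unary.Any using (Any; here; there)
import Data.List.Relation.Unary.Any.Properties as Any
open import Data.List.Relation.Unary.Unique.Propositional using (Unique)
open import Data.List.Relation.Unary.Unique.Propositional.Properties
  using (upTo⁺) renaming (filter⁺ to Unique-filter⁺)
open import Data.List.Membership.Propositional using (_∈_)
open import Data.List.Membership.Propositional.Properties using (∈-applyUpTo⁻)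
open import Data.List.Membership.DecPropositional _≟_ using (_∈?_)
open import Data.List.Relation.Binary.Permutation.Propositional using (_↭_; ↭-refl; ↭-sym; ↭-trans; ↭⇒↭ₛ)
open import Data.List.Relation.Binary.Permutation.Propositional.Properties using (↭-length; ↭-reverse; filter-↭)
open import Data.Product using (∃; ∃₂; _×_; _,_; proj₁; proj₂)
open import Data.Sum using (_⊎_; inj₁; inj₂)
open import Data.Empty using (⊥-elim)
open import Relation.Binary.PropositionalEquality
open import Data.List.Relation.Binary.Permutation.Setoid.Properties (setoid ℕ) using (Unique-resp-↭)
open import Relation.Binary.Definitions using (Irreflexive; Asymmetric; tri<; tri≈; tri>)
open import Relation.Nullary using (¬_; yes; no)
open import Relation.Unary using (Decidable)
open import Relation.Unary.Properties using (∁?)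
open import Function using (_∘_; flip)

AllPairs-resp-⊆ : ∀ {A : Set} {R : A → A → Set} {xs ys} → xs ⊆ ys → AllPairs R ys → AllPairs R xs
AllPairs-resp-⊆ []             []         = []
AllPairs-resp-⊆ (y ∷ʳ xs⊆ys)   (_ ∷ Rys)  = AllPairs-resp-⊆ xs⊆ys Rys
AllPairs-resp-⊆ (refl ∷ xs⊆ys) (Ry ∷ Rys) = All-resp-⊆ xs⊆ys Ry ∷ AllPairs-resp-⊆ xs⊆ys Rys

All-reverse : ∀ {A : Set} {P : A → Set} {xs} → All P xs → All P (reverse xs)
All-reverse Pxs = All.tabulate (All.lookup Pxs ∘ Any.reverse⁻)

AllPairs-reverse : ∀ {A : Set} {R : A → A → Set} {xs} → AllPairs R xs → AllPairs (flip R) (reverse xs)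
AllPairs-reverse {xs = []}     []         = []
AllPairs-reverse {xs = x ∷ xs} (Rx ∷ Rxs) rewrite unfold-reverse x xs =
  AllPairs.++⁺ (AllPairs-reverse Rxs) ([] ∷ []) (All.map (_∷ []) (All-reverse Rx))

length-filter-∁ : ∀ {A : Set} {P : A → Set} (P? : Decidable P) xs →
  length (filter P? xs) + length (filter (∁? P?) xs) ≡ length xs
length-filter-∁ P? []       = refl
length-filter-∁ P? (x ∷ xs) with P? x
... | yes _ = cong suc (length-filter-∁ P? xs)
... | no  _ = trans (+-suc _ _) (cong suc (length-filter-∁ P? xs))

+-≤-split : ∀ {a b c d} → a + b ≤ c + d → a ≤ c ⊎ b ≤ d
+-≤-split {a} {b} {c} {d} a+b≤c+d with a ≤? c
... | yes a≤c = inj₁ a≤c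
... | no  a≰c = inj₂ (+-cancelˡ-≤ c b d (≤-trans (n≤1+n (c + b)) 1+c+b≤c+d))
  where 1+c+b≤c+d = ≤-trans (+-monoˡ-≤ b (≰⇒> a≰c)) a+b≤c+d

Increasing : List ℕ → Set
Increasing = AllPairs _<_

upTo-increasing : ∀ r → Increasing (upTo r)
upTo-increasing r = AllPairs.applyUpTo⁺₁ (λ i → i) r (λ i<j _ → i<j)

∈-tail : ∀ {v y V} → v < y → y ∈ v ∷ V → y ∈ V
∈-tail v<y (here refl)  = ⊥-elim (<-irrefl refl v<y)
∈-tail v<y (there y∈V) = y∈V

increasing-∈⇒⊆ : ∀ {M V} → Increasing M → Increasing V → All (_∈ V) M → M ⊆ V
increasing-∈⇒⊆ {[]} _ _ _ = minimum _
increasing-∈⇒⊆ {x ∷ M} {v ∷ V} (x<M ∷ M↑) (v<V ∷ V↑) (here refl ∷ M∈) =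
  refl ∷ increasing-∈⇒⊆ M↑ V↑ (All.zipWith (λ (x<y , y∈) → ∈-tail x<y y∈) (x<M , M∈))
increasing-∈⇒⊆ {x ∷ M} {v ∷ V} (x<M ∷ M↑) (v<V ∷ V↑) (there x∈V ∷ M∈) =
  v ∷ʳ increasing-∈⇒⊆ (x<M ∷ M↑) V↑ (x∈V ∷ All.zipWith (λ (x<y , y∈) → ∈-tail (<-trans v<x x<y) y∈) (x<M , M∈))
  where v<x = All.lookup v<V x∈V

erdősSzekeresBound : ℕ → ℕ → ℕ
erdősSzekeresBound zero    n       = 0
erdősSzekeresBound (suc m) zero    = 0
erdősSzekeresBound (suc m) (suc n) = suc (erdősSzekeresBound m (suc n) + erdősSzekeresBound (suc m) n)

erdősSzekeres : ∀ m n {q} → Unique q → erdősSzekeresBound m n ≤ length q →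
  ∃ λ M → M ⊆ q × (Increasing M × length M ≡ m ⊎ AllPairs _>_ M × length M ≡ n)
erdősSzekeres zero    n       _ _ = [] , minimum _ , inj₁ ([] , refl)
erdősSzekeres (suc m) zero    _ _ = [] , minimum _ , inj₂ ([] , refl)
erdősSzekeres (suc m) (suc n) {a ∷ xs} (a∉xs ∷ xs!) (s≤s bound)
  with +-≤-split (subst (_ ≤_) (sym (length-filter-∁ (a <?_) xs)) bound)
... | inj₁ enoughAbove with erdősSzekeres m (suc n) (Unique-filter⁺ (a <?_) xs!) enoughAbove
...   | M , M⊆ , inj₁ (M↑ , len) =
  a ∷ M , refl ∷ ⊆-trans M⊆ (filter-⊆ _ xs) , inj₁ (All-resp-⊆ M⊆ (all-filter _ xs) ∷ M↑ , cong suc len)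
...   | M , M⊆ , inj₂ M↓ = M , a ∷ʳ ⊆-trans M⊆ (filter-⊆ _ xs) , inj₂ M↓
erdősSzekeres (suc m) (suc n) {a ∷ xs} (a∉xs ∷ xs!) (s≤s bound)
  | inj₂ enoughBelow with erdősSzekeres (suc m) n (Unique-filter⁺ (∁? (a <?_)) xs!) enoughBelow
...   | M , M⊆ , inj₁ M↑ = M , a ∷ʳ ⊆-trans M⊆ (filter-⊆ _ xs) , inj₁ M↑
...   | M , M⊆ , inj₂ (M↓ , len) =
  a ∷ M , refl ∷ ⊆-trans M⊆ (filter-⊆ _ xs) , inj₂ (All-resp-⊆ M⊆ below ∷ M↓ , cong suc len)
  where
  below : All (_< a) (filter (∁? (a <?_)) xs)
  below = All.zipWith (λ (a≮x , a≢x) → ≤∧≢⇒< (≮⇒≥ a≮x) (a≢x ∘ sym))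
            (all-filter _ xs , All-filter⁺ _ a∉xs)

_⊆±_ : List ℕ → List ℕ → Set
W ⊆± p = W ⊆ p ⊎ reverse W ⊆ p

⊆±-resp-⊆ : ∀ {V W p} → V ⊆ W → W ⊆± p → V ⊆± p
⊆±-resp-⊆ V⊆W (inj₁ W⊆p) = inj₁ (⊆-trans V⊆W W⊆p)
⊆±-resp-⊆ V⊆W (inj₂ W⊆p) = inj₂ (⊆-trans (reverse⁺ V⊆W) W⊆p)

-- Erdős–Szekeres applied to the order in which p lists the letters of W.
monotonePattern : ∀ m {u p W} → Unique u → p ↭ u → W ⊆ u → Increasing W →
  erdősSzekeresBound m m ≤ length W →
  ∃ λ W′ → W′ ⊆ W × Increasing W′ × length W′ ≡ m × W′ ⊆± p
monotonePattern m {u} {p} {W} u! p↭u W⊆u W↑ bound with erdősSzekeres m m q! (≤-trans bound W≤q)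
  where
  q = filter (_∈? W) p
  q! : Unique q
  q! = Unique-filter⁺ (_∈? W) (Unique-resp-↭ (↭⇒↭ₛ (↭-sym p↭u)) u!)
  W≤q : length W ≤ length q
  W≤q = begin
    length W                  ≡⟨ cong length (sym (filter-all (_∈? W) (All.tabulate (λ x∈ → x∈)))) ⟩
    length (filter (_∈? W) W) ≤⟨ length-mono-≤ (filter⁺ (_∈? W) (_∈? W) (λ { refl x∈ → x∈ }) W⊆u) ⟩
    length (filter (_∈? W) u) ≡⟨ ↭-length (filter-↭ (_∈? W) (↭-sym p↭u)) ⟩
    length q                  ∎
    where open ≤-Reasoning
... | M , M⊆q , inj₁ (M↑ , len) =
  M , increasing-∈⇒⊆ M↑ W↑ (All-resp-⊆ M⊆q (all-filter _ p)) , M↑ , len ,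
  inj₁ (⊆-trans M⊆q (filter-⊆ _ p))
... | M , M⊆q , inj₂ (M↓ , len) =
  reverse M , increasing-∈⇒⊆ (AllPairs-reverse M↓) W↑ (All-reverse (All-resp-⊆ M⊆q (all-filter _ p))) ,
  AllPairs-reverse M↓ , trans (length-reverse M) len ,
  inj₂ (subst (_⊆ p) (sym (reverse-involutive M)) (⊆-trans M⊆q (filter-⊆ _ p)))

iteratedBound : ℕ → ℕ → ℕ
iteratedBound k zero    = k
iteratedBound k (suc n) = erdősSzekeresBound (iteratedBound k n) (iteratedBound k n)

commonMonotonePattern : ∀ k {u} ps {W} → Unique u → All (_↭ u) ps → W ⊆ u → Increasing W →
  length W ≡ iteratedBound k (length ps) →
  ∃ λ W′ → W′ ⊆ W × Increasing W′ × length W′ ≡ k × All (W′ ⊆±_) ps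
commonMonotonePattern k []       _  []           _   W↑ len = _ , ⊆-refl , W↑ , len , []
commonMonotonePattern k (p ∷ ps) u! (p↭u ∷ ps↭u) W⊆u W↑ len
  with monotonePattern (iteratedBound k (length ps)) u! p↭u W⊆u W↑ (≤-reflexive (sym len))
... | W₁ , W₁⊆W , W₁↑ , len₁ , W₁⊆±p
  with commonMonotonePattern k ps u! ps↭u (⊆-trans W₁⊆W W⊆u) W₁↑ len₁
... | W′ , W′⊆W₁ , W′↑ , len′ , W′⊆±ps =
  W′ , ⊆-trans W′⊆W₁ W₁⊆W , W′↑ , len′ , ⊆±-resp-⊆ W′⊆W₁ W₁⊆±p ∷ W′⊆±ps

pigeonhole-⊆± : ∀ {W} ps a b → All (W ⊆±_) ps → a + b ≤ suc (length ps) →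
  W ^ˢ a ⊆ concat ps ⊎ reverse W ^ˢ b ⊆ concat ps
pigeonhole-⊆± ps zero    b       _ _ = inj₁ (minimum _)
pigeonhole-⊆± ps (suc a) zero    _ _ = inj₂ (minimum _)
pigeonhole-⊆± [] (suc a) (suc b) [] (s≤s a+1+b≤0) =
  ⊥-elim (1+n≢0 (trans (sym (+-suc a b)) (n≤0⇒n≡0 a+1+b≤0)))
pigeonhole-⊆± (p ∷ ps) (suc a) (suc b) (inj₁ W⊆p ∷ W⊆±ps) (s≤s bound)
  with pigeonhole-⊆± ps a (suc b) W⊆±ps bound
... | inj₁ Wᵃ⊆  = inj₁ (++⁺ W⊆p Wᵃ⊆)
... | inj₂ Wʳᵇ⊆ = inj₂ (++⁺ˡ p Wʳᵇ⊆)
pigeonhole-⊆± (p ∷ ps) (suc a) (suc b) (inj₂ Wʳ⊆p ∷ W⊆±ps) (s≤s bound)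
  with pigeonhole-⊆± ps (suc a) b W⊆±ps (subst (_≤ suc (length ps)) (+-suc a b) bound)
... | inj₁ Wᵃ⊆  = inj₁ (++⁺ˡ p Wᵃ⊆)
... | inj₂ Wʳᵇ⊆ = inj₂ (++⁺ Wʳ⊆p Wʳᵇ⊆)

map-^ˢ : ∀ (f : ℕ → ℕ) w t → map f (w ^ˢ t) ≡ map f w ^ˢ t
map-^ˢ f w zero    = refl
map-^ˢ f w (suc t) = trans (map-++ f w (w ^ˢ t)) (cong (map f w ++_) (map-^ˢ f w t))

∈-^ˢ⁻ : ∀ {x} w t → x ∈ w ^ˢ t → x ∈ w
∈-^ˢ⁻ w (suc t) x∈ with Any.++⁻ w x∈
... | inj₁ x∈w  = x∈w
... | inj₂ x∈wᵗ = ∈-^ˢ⁻ w t x∈wᵗ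

^ˢ⁺ : ∀ {u v} t → u ⊆ v → u ^ˢ t ⊆ v ^ˢ t
^ˢ⁺ zero    u⊆v = []
^ˢ⁺ (suc t) u⊆v = ++⁺ u⊆v (^ˢ⁺ t u⊆v)

orderContains-^ˢ : ∀ {S} (f : ℕ → ℕ) w t → (∀ {a b} → a ∈ w → b ∈ w → a < b → f a < f b) →
  map f w ^ˢ t ⊆ S → OrderContains S (w ^ˢ t)
orderContains-^ˢ {S} f w t f-mono fwᵗ⊆S =
  f , (λ a∈ b∈ → f-mono (∈-^ˢ⁻ w t a∈) (∈-^ˢ⁻ w t b∈)) , subst (_⊆ S) (sym (map-^ˢ f w t)) fwᵗ⊆S

-- nth is 0 past the end of the list; rank is shifted because the letters of ascending k are 1 … k.
nth : List ℕ → ℕ → ℕ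
nth []      i       = 0
nth (w ∷ W) zero    = w
nth (w ∷ W) (suc i) = nth W i

rank : List ℕ → ℕ → ℕ
rank W x = nth W (x ∸ 1)

nth-∈ : ∀ {W j} → j < length W → nth W j ∈ W
nth-∈ {w ∷ W} {zero}  _         = here refl
nth-∈ {w ∷ W} {suc j} (s≤s j<n) = there (nth-∈ j<n)

nth-mono : ∀ {W i j} → Increasing W → i < j → j < length W → nth W i < nth W j
nth-mono {w ∷ W} {zero}  {suc j} (w<W ∷ _)  _         (s≤s j<n) = All.lookup w<W (nth-∈ j<n)
nth-mono {w ∷ W} {suc i} {suc j} (_   ∷ W↑) (s≤s i<j) (s≤s j<n) = nth-mono W↑ i<j j<n

rank-mono : ∀ {W a b} → Increasing W → a ∈ ascending (length W) → b ∈ ascending (length W) →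
  a < b → rank W a < rank W b
rank-mono W↑ a∈ b∈ a<b with ∈-applyUpTo⁻ suc a∈ | ∈-applyUpTo⁻ suc b∈
... | i , _ , refl | j , j<n , refl = nth-mono W↑ (≤-pred a<b) j<n

applyUpTo-nth : ∀ W → applyUpTo (nth W) (length W) ≡ W
applyUpTo-nth []      = refl
applyUpTo-nth (w ∷ W) = cong (w ∷_) (applyUpTo-nth W)

map-rank-ascending : ∀ W → map (rank W) (ascending (length W)) ≡ W
map-rank-ascending W = trans (map-applyUpTo suc (rank W) (length W)) (applyUpTo-nth W)

map-rank-descending : ∀ W → map (rank W) (descending (length W)) ≡ reverse W
map-rank-descending W =
  trans (reverse-map (rank W) (ascending (length W))) (cong reverse (map-rank-ascending W))

monotonePowers : ℕ → ℕ → List (List ℕ)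
monotonePowers k t = ascending k ^ˢ t ∷ descending k ^ˢ t ∷ []

monotonePowers-orderContained : ∀ {W S} t → Increasing W → W ^ˢ t ⊆ S ⊎ reverse W ^ˢ t ⊆ S →
  Any (OrderContains S) (monotonePowers (length W) t)
monotonePowers-orderContained {W} t W↑ (inj₁ Wᵗ⊆S) =
  here (orderContains-^ˢ (rank W) _ t (rank-mono W↑)
    (subst (λ V → V ^ˢ t ⊆ _) (sym (map-rank-ascending W)) Wᵗ⊆S))
monotonePowers-orderContained {W} t W↑ (inj₂ Wʳᵗ⊆S) =
  there (here (orderContains-^ˢ (rank W) _ t
    (λ a∈ b∈ → rank-mono W↑ (Any.reverse⁻ a∈) (Any.reverse⁻ b∈))
    (subst (λ V → V ^ˢ t ⊆ _) (sym (map-rank-descending W)) Wʳᵗ⊆S)))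

monotonePowers-forced : ∀ k t s → 2 * t ≤ suc s → Forces (monotonePowers k t) s
monotonePowers-forced k t s 2t≤1+s = r , contains
  where
  r = iteratedBound k s
  t+t≤1+s : t + t ≤ suc s
  t+t≤1+s = subst (_≤ suc s) (cong (t +_) (+-identityʳ t)) 2t≤1+s
  contains : ∀ S → Formation r s S → Any (OrderContains S) (monotonePowers k t)
  contains _ (ps , refl , ps↭ , refl)
    with commonMonotonePattern k ps (upTo⁺ r) ps↭ ⊆-refl (upTo-increasing r) (length-applyUpTo (λ i → i) r)
  ... | W , _ , W↑ , refl , W⊆±ps = monotonePowers-orderContained t W↑ (pigeonhole-⊆± ps t t W⊆±ps t+t≤1+s)

zigzag : ℕ → List ℕ → List (List ℕ)
zigzag zero    p = []
zigzag (suc n) p = p ∷ zigzag n (reverse p)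

length-zigzag : ∀ n p → length (zigzag n p) ≡ n
length-zigzag zero    p = refl
length-zigzag (suc n) p = cong suc (length-zigzag n (reverse p))

zigzag-↭ : ∀ n {p u} → p ↭ u → All (_↭ u) (zigzag n p)
zigzag-↭ zero        p↭u = []
zigzag-↭ (suc n) {p} p↭u = p↭u ∷ zigzag-↭ n (↭-trans (↭-reverse p) p↭u)

alternation : ℕ → ℕ → ℕ → List ℕ
alternation x y zero    = []
alternation x y (suc m) = x ∷ alternation y x m

alternation-^ˢ : ∀ x y t → alternation x y (2 * t) ≡ (x ∷ y ∷ []) ^ˢ t
alternation-^ˢ x y zero = refl
alternation-^ˢ x y (suc t) rewrite +-suc t (t + 0) = cong (λ z → x ∷ y ∷ z) (alternation-^ˢ x y t)

-- How the first letters of an alternation x y x … embedded in p ++ q can fall into the chain p.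
data AlternationSplit (R : ℕ → ℕ → Set) (p q : List ℕ) (x y m : ℕ) : Set where
  none : alternation x y m ⊆ q → AlternationSplit R p q x y m
  one  : ∀ {m′} → m ≡ suc m′ → x ∈ p → alternation y x m′ ⊆ q → AlternationSplit R p q x y m
  two  : ∀ {m′} → m ≡ suc (suc m′) → R x y → y ∈ p → alternation x y m′ ⊆ q →
         AlternationSplit R p q x y m

alternation-⊆-++ : ∀ {R} → Irreflexive _≡_ R → ∀ {p q x y m} → AllPairs R p →
  alternation x y m ⊆ p ++ q → AlternationSplit R p q x y m
alternation-⊆-++ irr {m = zero} _ _ = none (minimum _)
alternation-⊆-++ irr {[]}    {m = suc m} [] s = none s
alternation-⊆-++ irr {a ∷ p} {m = suc m} (_ ∷ Rp) (.a ∷ʳ s) with alternation-⊆-++ irr Rp s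
... | none s′           = none s′
... | one  e x∈p s′     = one e (there x∈p) s′
... | two  e Rxy y∈p s′ = two e Rxy (there y∈p) s′
alternation-⊆-++ irr {a ∷ p} {m = suc m} (Ra ∷ Rp) (refl ∷ s) with alternation-⊆-++ irr Rp s
... | none s′           = one refl (here refl) s′
... | one  refl y∈p s′  = two refl (All.lookup Ra y∈p) (there y∈p) s′
... | two  refl _ a∈p _ = ⊥-elim (irr refl (All.lookup Ra a∈p))

alternation-bound : ∀ {R} → Irreflexive _≡_ R → Asymmetric R → ∀ n {p x y m} → AllPairs R p →
  alternation x y m ⊆ concat (zigzag n p) → (R x y → m ≤ suc n) × (R y x → m ≤ n)
alternation-bound irr asym zero    {m = zero}  _  _  = (λ _ → z≤n) , (λ _ → z≤n)
alternation-bound irr asym zero    {m = suc m} _  ()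
alternation-bound irr asym (suc n) Rp s with alternation-⊆-++ irr Rp s
... | none s′ = let (yx , xy) = alternation-bound (irr ∘ sym) asym n (AllPairs-reverse Rp) s′
                in m≤n⇒m≤1+n ∘ m≤n⇒m≤1+n ∘ xy , yx
... | one refl _ s′ = let (xy , yx) = alternation-bound (irr ∘ sym) asym n (AllPairs-reverse Rp) s′
                      in s≤s ∘ xy , s≤s ∘ yx
... | two refl Rxy _ s′ = let (_ , xy) = alternation-bound (irr ∘ sym) asym n (AllPairs-reverse Rp) s′
                          in s≤s ∘ s≤s ∘ xy , ⊥-elim ∘ asym Rxy

zigzag-alternation-bound : ∀ n r {x y m} → x ≢ y →
  alternation x y m ⊆ concat (zigzag n (upTo r)) → m ≤ suc n
zigzag-alternation-bound n r {x} {y} x≢y s with <-cmp x y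
... | tri< x<y _ _ = proj₁ (alternation-bound <-irrefl <-asym n (upTo-increasing r) s) x<y
... | tri≈ _ x≡y _ = ⊥-elim (x≢y x≡y)
... | tri> _ _ y<x = m≤n⇒m≤1+n (proj₂ (alternation-bound <-irrefl <-asym n (upTo-increasing r) s) y<x)

orderContains⇒alternation : ∀ {S w a b} t → OrderContains S (w ^ˢ suc t) → (a ∷ b ∷ []) ⊆ w → a ≢ b →
  ∃₂ λ x y → x ≢ y × alternation x y (2 * suc t) ⊆ S
orderContains⇒alternation {S} {w} {a} {b} t (f , f-mono , fwᵗ⊆S) ab⊆w a≢b =
  f a , f b , fa≢fb ,
  subst (_⊆ S) (sym (alternation-^ˢ (f a) (f b) (suc t))) (⊆-trans (^ˢ⁺ (suc t) (map⁺ f ab⊆w)) fwᵗ⊆S′)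
  where
  a∈ : a ∈ w ^ˢ suc t
  a∈ = Any.++⁺ˡ (lookup ab⊆w (here refl))
  b∈ : b ∈ w ^ˢ suc t
  b∈ = Any.++⁺ˡ (lookup ab⊆w (there (here refl)))
  fa≢fb : f a ≢ f b
  fa≢fb with <-cmp a b
  ... | tri< a<b _ _ = <⇒≢ (f-mono a∈ b∈ a<b)
  ... | tri≈ _ a≡b _ = ⊥-elim (a≢b a≡b)
  ... | tri> _ _ b<a = ≢-sym (<⇒≢ (f-mono b∈ a∈ b<a))
  fwᵗ⊆S′ : map f w ^ˢ suc t ⊆ S
  fwᵗ⊆S′ = subst (_⊆ S) (map-^ˢ f w (suc t)) fwᵗ⊆S

monotonePowers-unforced : ∀ k t s → 2 ≤ k → suc s < 2 * t → ¬ Forces (monotonePowers k t) s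
monotonePowers-unforced (suc zero) _ _ (s≤s ()) _
monotonePowers-unforced (suc (suc k)) (suc t) s _ 1+s<2t (r , forced) =
  refute (alternationIn (forced S (zigzag s (upTo r) , length-zigzag s _ , zigzag-↭ s ↭-refl , refl)))
  where
  S = concat (zigzag s (upTo r))
  12⊆ascending : (1 ∷ 2 ∷ []) ⊆ ascending (suc (suc k))
  12⊆ascending = refl ∷ refl ∷ minimum _
  alternationIn : Any (OrderContains S) (monotonePowers (suc (suc k)) (suc t)) →
    ∃₂ λ x y → x ≢ y × alternation x y (2 * suc t) ⊆ S
  alternationIn (here σ₁)         = orderContains⇒alternation t σ₁ 12⊆ascending λ ()
  alternationIn (there (here σ₂)) = orderContains⇒alternation t σ₂ (reverse⁺ 12⊆ascending) λ ()
  refute : ¬ ∃₂ λ x y → x ≢ y × alternation x y (2 * suc t) ⊆ S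
  refute (x , y , x≢y , alt⊆S) = <⇒≱ 1+s<2t (zigzag-alternation-bound s r x≢y alt⊆S)

mainTheorem2 : (k t : ℕ) → 2 ≤ k → 1 ≤ t →
    FormationWidth (ascending k ^ˢ t ∷ descending k ^ˢ t ∷ []) (2 * t ∸ 1)
mainTheorem2 k t 2≤k 1≤t =
  monotonePowers-forced k t (2 * t ∸ 1) (≤-reflexive (sym 1+[2t∸1]≡2t)) ,
  λ s s<2t∸1 → monotonePowers-unforced k t s 2≤k (subst (suc (suc s) ≤_) 1+[2t∸1]≡2t (s≤s s<2t∸1))
  where
  1+[2t∸1]≡2t : suc (2 * t ∸ 1) ≡ 2 * t
  1+[2t∸1]≡2t = m+[n∸m]≡n (≤-trans 1≤t (m≤m+n t (t + 0)))
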